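{- Suppose that $q(A_1)\subset\{1,\ldots,\ell(A_1)\}$ and let $d\in A_1$ with $q(d)=1$. There is $\lambda\in\Lambda_0$ such that $q(\lambda\cdot A)\cap\{0,6\}=\emptyset$ if one of the following conditions holds: (i) either $(\ell(A_1),\ell(A_2),\ell(A_4))=(5,0,1)$ and $\tilde e(d,d')\notin\{4,6\}$ for each $d'\in A_4$, or $(\ell(A_1),\ell(A_2),\ell(A_4))=(5,1,0)$ and $\tilde e(d,d')\notin\{2,3\}$ for each $d'\in A_2$; (ii) either $(\ell(A_1),\ell(A_2),\ell(A_4))=(4,0,2)$, or $(\ell(A_1),\ell(A_2),\ell(A_4))=(4,2,0)$ and $\tilde e(d,d')\ne 4$, where $q(A_2)=\{i,i+1\}$ and $d'\in A_2$ with $q(d')=i$; (iii) $(\ell(A_1),\ell(A_2),\ell(A_4))=(3,3,0)$.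
   Context: Fix an integer $m\ge 2$ and $N=7^{m+1}$. For an integer $x$ (or element of $\mathbb{Z}_N$), $q(x)\in\mathbb{Z}_7$ is the residue modulo $7$ of $\lfloor x/7^m\rfloor$ (depends only on $x$ mod $N$); residues of $\mathbb{Z}_7$ are written in $\{0,\dots,6\}$. $\Lambda_0=\{1+7^m k:0\le k\le 6\}\subset\mathbb{Z}_N$; $\lambda\cdot X=\{\lambda x:x\in X\}$. For $Y\subset\mathbb{Z}_7$, $\ell(Y)$ is the least $L\ge0$ with $Y\subseteq\{a,\dots,a+L-1\}$ (mod 7) for some $a$; for a set $X$ of integers $\ell(X)=\ell(q(X))$. $A$ is a set of five integers, none divisible by $7$, with residues modulo $7$ in $\{1,2,4\}$; $s\in\{1,2,4\}$ is a residue attained by a maximum number of elements of $A$; $A_1,A_2,A_4$ are the elements of $A$ congruent to $s,2s,4s$ modulo $7$. For $d\in A_1$: if $d'\in A_2$ then $\tilde e(d,d')=2q(d)-q(d')$; if $d'\in A_4$ then $\tilde e(d,d')=2q(d')-q(d)$ (in $\mathbb{Z}_7$). -}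

module Defs where

open import Data.Nat as ℕ using (ℕ; _^_; _≤_; _<_)
open import Data.Nat.Properties using (m^n≢0)
open import Data.Integer as ℤ using (ℤ; +_; _/ℕ_; _%ℕ_)
open import Data.List using (List; length; filter)
open import Data.List.Membership.Propositional using (_∈_)
open import Data.Product using (Σ; ∃; ∃-syntax; _×_; _,_)
open import Data.Sum using (_⊎_)
open import Relation.Binary.PropositionalEquality using (_≡_; _≢_)
open import Relation.Nullary using (¬_)

res7 : ℤ → ℕ
res7 x = x %ℕ 7

-- q(x) = floor(x / 7^m) mod 7  (floor division; depends only on x mod 7^(m+1)).
q : ℕ → ℤ → ℕ
q m x = (_/ℕ_ x (7 ^ m) {{m^n≢0 7 m}}) %ℕ 7

-- Subsets of Z_7 (residues written in {0,...,6}) are predicates on ℕ.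
-- Y ⊆ {a, ..., a+L-1} (mod 7) for some a.
Covers : (ℕ → Set) → ℕ → Set
Covers Y L = ∃[ a ] (a < 7 × (∀ y → Y y → ∃[ j ] (j < L × (a ℕ.+ j) ℕ.% 7 ≡ y)))

Len : (ℕ → Set) → ℕ → Set
Len Y L = Covers Y L × (∀ L' → Covers Y L' → L ≤ L')

IsQR : ℕ → Set
IsQR r = r ≡ 1 ⊎ r ≡ 2 ⊎ r ≡ 4

count : List ℤ → ℕ → ℕ
count A t = length (filter (λ x → res7 x ℕ.≟ t) A)

InPart : List ℤ → ℕ → ℤ → Set
InPart A r x = x ∈ A × res7 x ≡ r ℕ.% 7

qPart : ℕ → List ℤ → ℕ → ℕ → Set
qPart m A r y = ∃[ x ] (InPart A r x × q m x ≡ y)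

-- ẽ(d,d') = 2 q(d) - q(d')  (d ∈ A_1, d' ∈ A_2), in Z_7.
etilde2 : ℕ → ℤ → ℤ → ℕ
etilde2 m d d' = ((+ 2) ℤ.* (+ q m d) ℤ.- (+ q m d')) %ℕ 7

-- ẽ(d,d') = 2 q(d') - q(d)  (d ∈ A_1, d' ∈ A_4), in Z_7.
etilde4 : ℕ → ℤ → ℤ → ℕ
etilde4 m d d' = ((+ 2) ℤ.* (+ q m d') ℤ.- (+ q m d)) %ℕ 7

-- λ = 1 + 7^m k ∈ Λ_0 (as an integer; λ·x is then reduced mod N implicitly by q).
lam : ℕ → ℕ → ℤ
lam m k = + (1 ℕ.+ 7 ^ m ℕ.* k)

module Submission where

-- For λ = 1 + 7^m k ∈ Λ₀ we have λx = x + (kx)·7^m, hence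
--   q(λx) = q(x) + k·(x mod 7)   in ℤ₇.
-- So λ moves every element of A by an amount that depends only on its residue
-- class.  Since s³ ≡ 1 (mod 7) for s ∈ {1,2,4}, choosing k = t·s² moves the
-- classes A₁, A₂, A₄ rigidly by t, 2t, 4t.  It therefore suffices to find a
-- t ∈ ℤ₇ after which every q(A_j) lies in {1,…,5}.  The hypotheses place q(A₁) in
-- [1, ℓ(A₁)] and each of q(A₂), q(A₄) in a window of length ℓ(A₂), ℓ(A₄) (empty
-- when the length is 0); a window is carried into {1,…,5} as soon as its shifted
-- start and length fit there, and for each case a small table of shifts t ∈ {0,1,2}
-- makes all windows fit.  The hypotheses on ẽ(d,d') exclude exactly the
-- configurations no table can handle: in case (i) they keep q(A₄), resp. q(A₂),
-- off {0,6}; in case (ii) they forbid q(A₂) = {5,6}.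

open import Defs
open import Data.Nat as ℕ using (ℕ; suc; _^_; _≤_; _<_; z≤n; s≤s; NonZero)
open import Data.Nat.Properties as ℕP using (m^n≢0)
open import Data.Nat.DivMod as ℕD using (%-distribˡ-+; %-distribˡ-*; m%n%n≡m%n; m<n⇒m%n≡m)
open import Data.Nat.Tactic.RingSolver as ℕSolver using ()
open import Data.Integer as ℤ using (ℤ; +_; _/ℕ_; _%ℕ_; ∣_∣; _⊖_)
open import Data.Integer.Properties as ℤP using ()
open import Data.Integer.DivMod using (a≡a%ℕn+[a/ℕn]*n; n%ℕd<d)
open import Data.Integer.Tactic.RingSolver as ℤSolver using ()
open import Data.List using (List; length)
open import Data.List.Membership.Propositional using (_∈_; find; lose)
open import Data.List.Relation.Unary.Any using (Any; any?)
open import Data.List.Relation.Unary.Unique.Propositional using (Unique)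
open import Data.Empty using (⊥-elim)
open import Data.Product using (∃-syntax; _×_; _,_; proj₁; proj₂)
open import Data.Sum using (_⊎_; inj₁; inj₂)
open import Relation.Binary.PropositionalEquality
  using (_≡_; _≢_; refl; sym; trans; cong; cong₂; subst; module ≡-Reasoning)
open import Relation.Nullary using (¬_; Dec; yes; no)
open import Relation.Nullary.Decidable using (True; toWitness; map′; _×-dec_)

-- Euclidean division in ℤ by a positive natural number

-- Two Euclidean decompositions z = r + t·d with 0 ≤ r < d coincide: the
-- difference of the quotients times d is a difference of remainders, below d.
euclid-unique : ∀ d r r′ t t′ → r < d → r′ < d →
  + r ℤ.+ t ℤ.* + d ≡ + r′ ℤ.+ t′ ℤ.* + d → t ≡ t′ × r ≡ r′
euclid-unique d r r′ t t′ r<d r′<d eq = t≡t′ , r≡r′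
  where
  gap : (t ℤ.- t′) ℤ.* + d ≡ + r′ ℤ.- + r
  gap = begin
    (t ℤ.- t′) ℤ.* + d                            ≡⟨ difference (+ r) t t′ (+ d) ⟩
    (+ r ℤ.+ t ℤ.* + d) ℤ.- (+ r ℤ.+ t′ ℤ.* + d)   ≡⟨ cong (ℤ._- (+ r ℤ.+ t′ ℤ.* + d)) eq ⟩
    (+ r′ ℤ.+ t′ ℤ.* + d) ℤ.- (+ r ℤ.+ t′ ℤ.* + d) ≡⟨ cancel (+ r′) (+ r) (t′ ℤ.* + d) ⟩
    + r′ ℤ.- + r                                  ∎
    where
    open ≡-Reasoning
    difference : ∀ a t t′ d → (t ℤ.- t′) ℤ.* d ≡ (a ℤ.+ t ℤ.* d) ℤ.- (a ℤ.+ t′ ℤ.* d)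
    difference = ℤSolver.solve-∀
    cancel : ∀ a b u → (a ℤ.+ u) ℤ.- (b ℤ.+ u) ≡ a ℤ.- b
    cancel = ℤSolver.solve-∀
  small : ∣ t ℤ.- t′ ∣ ℕ.* d < 1 ℕ.* d
  small = begin-strict
    ∣ t ℤ.- t′ ∣ ℕ.* d     ≡⟨ sym (ℤP.abs-* (t ℤ.- t′) (+ d)) ⟩
    ∣ (t ℤ.- t′) ℤ.* + d ∣ ≡⟨ cong ∣_∣ (trans gap (ℤP.[+m]-[+n]≡m⊖n r′ r)) ⟩
    ∣ r′ ⊖ r ∣             ≤⟨ ℤP.∣m⊝n∣≤m⊔n r′ r ⟩
    r′ ℕ.⊔ r               <⟨ ℕP.⊔-lub r′<d r<d ⟩
    d                      ≡⟨ sym (ℕP.*-identityˡ d) ⟩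
    1 ℕ.* d                ∎
    where open ℕP.≤-Reasoning
  t≡t′ : t ≡ t′
  t≡t′ = ℤP.i-j≡0⇒i≡j t t′
           (ℤP.∣i∣≡0⇒i≡0 (ℕP.n<1⇒n≡0 (ℕP.*-cancelʳ-< d _ 1 small)))
  r≡r′ : r ≡ r′
  r≡r′ = ℤP.+-injective (sym (ℤP.i-j≡0⇒i≡j (+ r′) (+ r) (begin
    + r′ ℤ.- + r        ≡⟨ sym gap ⟩
    (t ℤ.- t′) ℤ.* + d  ≡⟨ cong (λ u → (u ℤ.- t′) ℤ.* + d) t≡t′ ⟩
    (t′ ℤ.- t′) ℤ.* + d ≡⟨ cong (ℤ._* + d) (ℤP.+-inverseʳ t′) ⟩
    + 0 ℤ.* + d         ≡⟨ ℤP.*-zeroˡ (+ d) ⟩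
    + 0                 ∎)))
    where open ≡-Reasoning

div-mod-shift : ∀ z t d .{{_ : NonZero d}} →
  (z ℤ.+ t ℤ.* + d) /ℕ d ≡ z /ℕ d ℤ.+ t × (z ℤ.+ t ℤ.* + d) %ℕ d ≡ z %ℕ d
div-mod-shift z t d =
  euclid-unique d _ _ _ _ (n%ℕd<d (z ℤ.+ t ℤ.* + d) d) (n%ℕd<d z d) (begin
    + ((z ℤ.+ t ℤ.* + d) %ℕ d) ℤ.+ ((z ℤ.+ t ℤ.* + d) /ℕ d) ℤ.* + d
      ≡⟨ sym (a≡a%ℕn+[a/ℕn]*n (z ℤ.+ t ℤ.* + d) d) ⟩
    z ℤ.+ t ℤ.* + d
      ≡⟨ cong (ℤ._+ t ℤ.* + d) (a≡a%ℕn+[a/ℕn]*n z d) ⟩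
    (+ (z %ℕ d) ℤ.+ (z /ℕ d) ℤ.* + d) ℤ.+ t ℤ.* + d
      ≡⟨ collect (+ (z %ℕ d)) (z /ℕ d) t (+ d) ⟩
    + (z %ℕ d) ℤ.+ (z /ℕ d ℤ.+ t) ℤ.* + d ∎)
  where
  open ≡-Reasoning
  collect : ∀ a b t d → (a ℤ.+ b ℤ.* d) ℤ.+ t ℤ.* d ≡ a ℤ.+ (b ℤ.+ t) ℤ.* d
  collect = ℤSolver.solve-∀

%ℕ-linear : ∀ b x k d .{{_ : NonZero d}} →
  (b ℤ.+ + k ℤ.* x) %ℕ d ≡ (b %ℕ d ℕ.+ k ℕ.* (x %ℕ d)) ℕ.% d
%ℕ-linear b x k d = begin
  (b ℤ.+ + k ℤ.* x) %ℕ d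
    ≡⟨ cong (_%ℕ d) decomposition ⟩
  (+ n ℤ.+ (b /ℕ d ℤ.+ + k ℤ.* (x /ℕ d)) ℤ.* + d) %ℕ d
    ≡⟨ proj₂ (div-mod-shift (+ n) (b /ℕ d ℤ.+ + k ℤ.* (x /ℕ d)) d) ⟩
  n ℕ.% d ∎
  where
  open ≡-Reasoning
  n = b %ℕ d ℕ.+ k ℕ.* (x %ℕ d)
  decomposition : b ℤ.+ + k ℤ.* x ≡ + n ℤ.+ (b /ℕ d ℤ.+ + k ℤ.* (x /ℕ d)) ℤ.* + d
  decomposition = begin
    b ℤ.+ + k ℤ.* x
      ≡⟨ cong₂ (λ u v → u ℤ.+ + k ℤ.* v) (a≡a%ℕn+[a/ℕn]*n b d) (a≡a%ℕn+[a/ℕn]*n x d) ⟩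
    (+ (b %ℕ d) ℤ.+ b /ℕ d ℤ.* + d) ℤ.+ + k ℤ.* (+ (x %ℕ d) ℤ.+ x /ℕ d ℤ.* + d)
      ≡⟨ collect (+ (b %ℕ d)) (b /ℕ d) (+ k) (+ (x %ℕ d)) (x /ℕ d) (+ d) ⟩
    (+ (b %ℕ d) ℤ.+ + k ℤ.* + (x %ℕ d)) ℤ.+ (b /ℕ d ℤ.+ + k ℤ.* (x /ℕ d)) ℤ.* + d
      ≡⟨ cong (λ u → (+ (b %ℕ d) ℤ.+ u) ℤ.+ (b /ℕ d ℤ.+ + k ℤ.* (x /ℕ d)) ℤ.* + d)
              (sym (ℤP.pos-* k (x %ℕ d))) ⟩
    (+ (b %ℕ d) ℤ.+ + (k ℕ.* (x %ℕ d))) ℤ.+ (b /ℕ d ℤ.+ + k ℤ.* (x /ℕ d)) ℤ.* + d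
      ≡⟨ cong (ℤ._+ (b /ℕ d ℤ.+ + k ℤ.* (x /ℕ d)) ℤ.* + d) (sym (ℤP.pos-+ (b %ℕ d) _)) ⟩
    + n ℤ.+ (b /ℕ d ℤ.+ + k ℤ.* (x /ℕ d)) ℤ.* + d ∎
    where
    collect : ∀ a u k c v d → (a ℤ.+ u ℤ.* d) ℤ.+ k ℤ.* (c ℤ.+ v ℤ.* d)
                            ≡ (a ℤ.+ k ℤ.* c) ℤ.+ (u ℤ.+ k ℤ.* v) ℤ.* d
    collect = ℤSolver.solve-∀

-- The action of Λ₀ on q

lam-expand : ∀ m k x → lam m k ℤ.* x ≡ x ℤ.+ (+ k ℤ.* x) ℤ.* + (7 ^ m)
lam-expand m k x = begin
  lam m k ℤ.* x                   ≡⟨ cong (ℤ._* x) (ℤP.pos-+ 1 (7 ^ m ℕ.* k)) ⟩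
  (+ 1 ℤ.+ + (7 ^ m ℕ.* k)) ℤ.* x ≡⟨ cong (λ u → (+ 1 ℤ.+ u) ℤ.* x) (ℤP.pos-* (7 ^ m) k) ⟩
  (+ 1 ℤ.+ + (7 ^ m) ℤ.* + k) ℤ.* x ≡⟨ expand (+ (7 ^ m)) (+ k) x ⟩
  x ℤ.+ (+ k ℤ.* x) ℤ.* + (7 ^ m) ∎
  where
  open ≡-Reasoning
  expand : ∀ p k x → (+ 1 ℤ.+ p ℤ.* k) ℤ.* x ≡ x ℤ.+ (k ℤ.* x) ℤ.* p
  expand = ℤSolver.solve-∀

q-lam : ∀ m k x → q m (lam m k ℤ.* x) ≡ (q m x ℕ.+ k ℕ.* res7 x) ℕ.% 7
q-lam m k x = begin
  q m (lam m k ℤ.* x)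
    ≡⟨ cong (λ z → _/ℕ_ z (7 ^ m) {{m^n≢0 7 m}} %ℕ 7) (lam-expand m k x) ⟩
  _/ℕ_ (x ℤ.+ (+ k ℤ.* x) ℤ.* + (7 ^ m)) (7 ^ m) {{m^n≢0 7 m}} %ℕ 7
    ≡⟨ cong (_%ℕ 7) (proj₁ (div-mod-shift x (+ k ℤ.* x) (7 ^ m) {{m^n≢0 7 m}})) ⟩
  (_/ℕ_ x (7 ^ m) {{m^n≢0 7 m}} ℤ.+ + k ℤ.* x) %ℕ 7
    ≡⟨ %ℕ-linear (_/ℕ_ x (7 ^ m) {{m^n≢0 7 m}}) x k 7 ⟩
  (q m x ℕ.+ k ℕ.* res7 x) ℕ.% 7 ∎
  where open ≡-Reasoning

-- The multiplier k = t·s²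

%-absorbʳ : ∀ y n d .{{_ : NonZero d}} → (y ℕ.+ n ℕ.% d) ℕ.% d ≡ (y ℕ.+ n) ℕ.% d
%-absorbʳ y n d = begin
  (y ℕ.+ n ℕ.% d) ℕ.% d            ≡⟨ %-distribˡ-+ y (n ℕ.% d) d ⟩
  (y ℕ.% d ℕ.+ n ℕ.% d ℕ.% d) ℕ.% d ≡⟨ cong (λ u → (y ℕ.% d ℕ.+ u) ℕ.% d) (m%n%n≡m%n n d) ⟩
  (y ℕ.% d ℕ.+ n ℕ.% d) ℕ.% d      ≡⟨ sym (%-distribˡ-+ y n d) ⟩
  (y ℕ.+ n) ℕ.% d                  ∎
  where open ≡-Reasoning

%-absorbˡ : ∀ n y d .{{_ : NonZero d}} → (n ℕ.% d ℕ.+ y) ℕ.% d ≡ (n ℕ.+ y) ℕ.% d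
%-absorbˡ n y d = begin
  (n ℕ.% d ℕ.+ y) ℕ.% d ≡⟨ cong (ℕ._% d) (ℕP.+-comm (n ℕ.% d) y) ⟩
  (y ℕ.+ n ℕ.% d) ℕ.% d ≡⟨ %-absorbʳ y n d ⟩
  (y ℕ.+ n) ℕ.% d       ≡⟨ cong (ℕ._% d) (ℕP.+-comm y n) ⟩
  (n ℕ.+ y) ℕ.% d       ∎
  where open ≡-Reasoning

-- If s³ ≡ 1 (mod d), then k = t·s² moves the class j·s by exactly j·t.
cube-root-shift : ∀ d .{{_ : NonZero d}} s t j y → (s ℕ.* s ℕ.* s) ℕ.% d ≡ 1 →
  (y ℕ.+ (t ℕ.* s ℕ.* s) ℕ.% d ℕ.* ((j ℕ.* s) ℕ.% d)) ℕ.% d ≡ (y ℕ.+ j ℕ.* t) ℕ.% d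
cube-root-shift d s t j y s³≡1 = begin
  (y ℕ.+ (t ℕ.* s ℕ.* s) ℕ.% d ℕ.* ((j ℕ.* s) ℕ.% d)) ℕ.% d
    ≡⟨ sym (%-absorbʳ y _ d) ⟩
  (y ℕ.+ ((t ℕ.* s ℕ.* s) ℕ.% d ℕ.* ((j ℕ.* s) ℕ.% d)) ℕ.% d) ℕ.% d
    ≡⟨ cong (λ u → (y ℕ.+ u) ℕ.% d) (sym (%-distribˡ-* (t ℕ.* s ℕ.* s) (j ℕ.* s) d)) ⟩
  (y ℕ.+ ((t ℕ.* s ℕ.* s) ℕ.* (j ℕ.* s)) ℕ.% d) ℕ.% d
    ≡⟨ cong (λ u → (y ℕ.+ u ℕ.% d) ℕ.% d) (regroup t s j) ⟩
  (y ℕ.+ ((j ℕ.* t) ℕ.* (s ℕ.* s ℕ.* s)) ℕ.% d) ℕ.% d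
    ≡⟨ cong (λ u → (y ℕ.+ u) ℕ.% d) (%-distribˡ-* (j ℕ.* t) (s ℕ.* s ℕ.* s) d) ⟩
  (y ℕ.+ ((j ℕ.* t) ℕ.% d ℕ.* ((s ℕ.* s ℕ.* s) ℕ.% d)) ℕ.% d) ℕ.% d
    ≡⟨ cong (λ u → (y ℕ.+ ((j ℕ.* t) ℕ.% d ℕ.* u) ℕ.% d) ℕ.% d) s³≡1 ⟩
  (y ℕ.+ ((j ℕ.* t) ℕ.% d ℕ.* 1) ℕ.% d) ℕ.% d
    ≡⟨ cong (λ u → (y ℕ.+ u ℕ.% d) ℕ.% d) (ℕP.*-identityʳ ((j ℕ.* t) ℕ.% d)) ⟩
  (y ℕ.+ (j ℕ.* t) ℕ.% d ℕ.% d) ℕ.% d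
    ≡⟨ cong (λ u → (y ℕ.+ u) ℕ.% d) (m%n%n≡m%n (j ℕ.* t) d) ⟩
  (y ℕ.+ (j ℕ.* t) ℕ.% d) ℕ.% d
    ≡⟨ %-absorbʳ y (j ℕ.* t) d ⟩
  (y ℕ.+ j ℕ.* t) ℕ.% d ∎
  where
  open ≡-Reasoning
  regroup : ∀ t s j → (t ℕ.* s ℕ.* s) ℕ.* (j ℕ.* s) ≡ (j ℕ.* t) ℕ.* (s ℕ.* s ℕ.* s)
  regroup = ℕSolver.solve-∀

qr-cube : ∀ {s} → IsQR s → (s ℕ.* s ℕ.* s) ℕ.% 7 ≡ 1
qr-cube (inj₁ refl)        = refl
qr-cube (inj₂ (inj₁ refl)) = refl
qr-cube (inj₂ (inj₂ refl)) = refl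

qr-classes : ∀ {s r} → IsQR s → IsQR r →
  r ≡ s ℕ.% 7 ⊎ r ≡ (2 ℕ.* s) ℕ.% 7 ⊎ r ≡ (4 ℕ.* s) ℕ.% 7
qr-classes (inj₁ refl)        (inj₁ refl)        = inj₁ refl
qr-classes (inj₁ refl)        (inj₂ (inj₁ refl)) = inj₂ (inj₁ refl)
qr-classes (inj₁ refl)        (inj₂ (inj₂ refl)) = inj₂ (inj₂ refl)
qr-classes (inj₂ (inj₁ refl)) (inj₁ refl)        = inj₂ (inj₂ refl)
qr-classes (inj₂ (inj₁ refl)) (inj₂ (inj₁ refl)) = inj₁ refl
qr-classes (inj₂ (inj₁ refl)) (inj₂ (inj₂ refl)) = inj₂ (inj₁ refl)
qr-classes (inj₂ (inj₂ refl)) (inj₁ refl)        = inj₂ (inj₁ refl)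
qr-classes (inj₂ (inj₂ refl)) (inj₂ (inj₁ refl)) = inj₂ (inj₂ refl)
qr-classes (inj₂ (inj₂ refl)) (inj₂ (inj₂ refl)) = inj₁ refl

Safe : ℕ → Set
Safe y = y ≢ 0 × y ≢ 6

Avoids06 : ℕ → List ℤ → Set
Avoids06 m A = ∃[ k ] (k ≤ 6 × (∀ x → x ∈ A → Safe (q m (lam m k ℤ.* x))))

SafeAfter : (ℕ → Set) → ℕ → Set
SafeAfter Y c = ∀ y → Y y → Safe ((y ℕ.+ c) ℕ.% 7)

InWindow : ℕ → ℕ → ℕ → Set
InWindow a L y = ∃[ j ] (j < L × (a ℕ.+ j) ℕ.% 7 ≡ y)

Fits : ℕ → ℕ → Set
Fits a L = 1 ≤ a × a ℕ.+ L ≤ 6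

fits : ∀ a L → {True (1 ℕ.≤? a ×-dec a ℕ.+ L ℕ.≤? 6)} → Fits a L
fits a L {p} = toWitness p

between⇒safe : ∀ {y} → 1 ≤ y → y < 6 → Safe y
between⇒safe {suc y} _ y<6 = (λ ()) , λ y≡6 → ℕP.<-irrefl y≡6 y<6

window-shift : ∀ {a L y} c → InWindow a L y → InWindow ((a ℕ.+ c) ℕ.% 7) L ((y ℕ.+ c) ℕ.% 7)
window-shift {a} {L} {y} c (j , j<L , a+j≡y) = j , j<L , (begin
  ((a ℕ.+ c) ℕ.% 7 ℕ.+ j) ℕ.% 7 ≡⟨ %-absorbˡ (a ℕ.+ c) j 7 ⟩
  (a ℕ.+ c ℕ.+ j) ℕ.% 7         ≡⟨ cong (ℕ._% 7) (swap a c j) ⟩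
  (a ℕ.+ j ℕ.+ c) ℕ.% 7         ≡⟨ sym (%-absorbˡ (a ℕ.+ j) c 7) ⟩
  ((a ℕ.+ j) ℕ.% 7 ℕ.+ c) ℕ.% 7 ≡⟨ cong (λ u → (u ℕ.+ c) ℕ.% 7) a+j≡y ⟩
  (y ℕ.+ c) ℕ.% 7               ∎)
  where
  open ≡-Reasoning
  swap : ∀ a c j → a ℕ.+ c ℕ.+ j ≡ a ℕ.+ j ℕ.+ c
  swap = ℕSolver.solve-∀

fits⇒safe : ∀ {a L y} → Fits a L → InWindow a L y → Safe y
fits⇒safe {a} {L} (1≤a , a+L≤6) (j , j<L , a+j≡y) =
  subst Safe (trans (sym (m<n⇒m%n≡m a+j<7)) a+j≡y)
    (between⇒safe (ℕP.≤-trans 1≤a (ℕP.m≤m+n a j)) a+j<6)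
  where
  a+j<6 : a ℕ.+ j < 6
  a+j<6 = ℕP.<-≤-trans (ℕP.+-monoʳ-< a j<L) a+L≤6
  a+j<7 : a ℕ.+ j < 7
  a+j<7 = ℕP.m<n⇒m<1+n a+j<6

window-safe : ∀ {Y : ℕ → Set} a {L c} → Fits ((a ℕ.+ c) ℕ.% 7) L →
  (∀ y → Y y → InWindow a L y) → SafeAfter Y c
window-safe a {L} {c} fit inside y Yy =
  fits⇒safe {(a ℕ.+ c) ℕ.% 7} {L} fit (window-shift {a} {L} {y} c (inside y Yy))

empty-safe : ∀ {Y : ℕ → Set} {c} → Covers Y 0 → SafeAfter Y c
empty-safe (_ , _ , inside) y Yy with inside y Yy
... | _ , () , _

unshifted-safe : ∀ {Y : ℕ → Set} → (∀ y → Y y → y < 7 × Safe y) → SafeAfter Y 0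
unshifted-safe safe y Yy = subst Safe (sym y+0%7≡y) (proj₂ (safe y Yy))
  where
  y+0%7≡y : (y ℕ.+ 0) ℕ.% 7 ≡ y
  y+0%7≡y = trans (cong (ℕ._% 7) (ℕP.+-identityʳ y)) (m<n⇒m%n≡m (proj₁ (safe y Yy)))

interval-window : ∀ {y L} → y < 7 → 1 ≤ y → y ≤ L → InWindow 1 L y
interval-window {suc y} y<7 _ y<L = y , y<L , m<n⇒m%n≡m y<7

window₂-members : ∀ {a y} → InWindow a 2 y → y ≡ a ℕ.% 7 ⊎ y ≡ (a ℕ.+ 1) ℕ.% 7
window₂-members {a} (0 , _ , e) = inj₁ (trans (sym e) (cong (ℕ._% 7) (ℕP.+-identityʳ a)))
window₂-members (1 , _ , e) = inj₂ (sym e)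
window₂-members (suc (suc _) , s≤s (s≤s ()) , _)

q<7 : ∀ m x → q m x < 7
q<7 m x = n%ℕd<d (_/ℕ_ x (7 ^ m) {{m^n≢0 7 m}}) 7

qPart<7 : ∀ {m A r y} → qPart m A r y → y < 7
qPart<7 {m} (x , _ , refl) = q<7 m x

qPart? : ∀ m A r y → Dec (qPart m A r y)
qPart? m A r y = map′ from-any to-any (any? (λ x → (res7 x ℕ.≟ r ℕ.% 7) ×-dec (q m x ℕ.≟ y)) A)
  where
  P : ℤ → Set
  P x = res7 x ≡ r ℕ.% 7 × q m x ≡ y
  from-any : Any P A → qPart m A r y
  from-any found with find found
  ... | x , x∈A , rx , qx = x , (x∈A , rx) , qx
  to-any : qPart m A r y → Any P A
  to-any (x , (x∈A , rx) , qx) = lose x∈A (rx , qx)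

etilde4-at : ∀ m d d′ y → q m d ≡ 1 → q m d′ ≡ y →
  etilde4 m d d′ ≡ ((+ 2) ℤ.* (+ y) ℤ.- (+ 1)) %ℕ 7
etilde4-at m d d′ y qd qd′ = cong₂ (λ u v → ((+ 2) ℤ.* (+ v) ℤ.- (+ u)) %ℕ 7) qd qd′

etilde2-at : ∀ m d d′ y → q m d ≡ 1 → q m d′ ≡ y →
  etilde2 m d d′ ≡ ((+ 2) ℤ.* (+ 1) ℤ.- (+ y)) %ℕ 7
etilde2-at m d d′ y qd qd′ = cong₂ (λ u v → ((+ 2) ℤ.* (+ u) ℤ.- (+ v)) %ℕ 7) qd qd′

-- Tables of shifts: for every window start a, a shift t carrying q(A₁) ⊆ [1, L₁]
-- and the window of the other class (moved by 2t or 4t) into {1,…,5}.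

shifts-ii₄ : ∀ b → b < 7 → ∃[ t ] (Fits ((1 ℕ.+ t) ℕ.% 7) 4 × Fits ((b ℕ.+ 4 ℕ.* t) ℕ.% 7) 2)
shifts-ii₄ 0 _ = 1 , fits 2 4 , fits 4 2
shifts-ii₄ 1 _ = 0 , fits 1 4 , fits 1 2
shifts-ii₄ 2 _ = 0 , fits 1 4 , fits 2 2
shifts-ii₄ 3 _ = 0 , fits 1 4 , fits 3 2
shifts-ii₄ 4 _ = 0 , fits 1 4 , fits 4 2
shifts-ii₄ 5 _ = 1 , fits 2 4 , fits 2 2
shifts-ii₄ 6 _ = 1 , fits 2 4 , fits 3 2
shifts-ii₄ (suc (suc (suc (suc (suc (suc (suc _))))))) (s≤s (s≤s (s≤s (s≤s (s≤s (s≤s (s≤s ())))))))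

-- Case (ii), ℓ(A₂) = 2: A₂ is moved by 2t; the start 5 admits no shift.
shifts-ii₂ : ∀ a → a < 7 → a ≢ 5 → ∃[ t ] (Fits ((1 ℕ.+ t) ℕ.% 7) 4 × Fits ((a ℕ.+ 2 ℕ.* t) ℕ.% 7) 2)
shifts-ii₂ 0 _ _ = 1 , fits 2 4 , fits 2 2
shifts-ii₂ 1 _ _ = 0 , fits 1 4 , fits 1 2
shifts-ii₂ 2 _ _ = 0 , fits 1 4 , fits 2 2
shifts-ii₂ 3 _ _ = 0 , fits 1 4 , fits 3 2
shifts-ii₂ 4 _ _ = 0 , fits 1 4 , fits 4 2
shifts-ii₂ 5 _ a≢5 = ⊥-elim (a≢5 refl)
shifts-ii₂ 6 _ _ = 1 , fits 2 4 , fits 1 2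
shifts-ii₂ (suc (suc (suc (suc (suc (suc (suc _))))))) (s≤s (s≤s (s≤s (s≤s (s≤s (s≤s (s≤s ()))))))) _

shifts-iii : ∀ a → a < 7 → ∃[ t ] (Fits ((1 ℕ.+ t) ℕ.% 7) 3 × Fits ((a ℕ.+ 2 ℕ.* t) ℕ.% 7) 3)
shifts-iii 0 _ = 1 , fits 2 3 , fits 2 3
shifts-iii 1 _ = 0 , fits 1 3 , fits 1 3
shifts-iii 2 _ = 0 , fits 1 3 , fits 2 3
shifts-iii 3 _ = 0 , fits 1 3 , fits 3 3
shifts-iii 4 _ = 2 , fits 3 3 , fits 1 3
shifts-iii 5 _ = 2 , fits 3 3 , fits 2 3
shifts-iii 6 _ = 1 , fits 2 3 , fits 1 3
shifts-iii (suc (suc (suc (suc (suc (suc (suc _))))))) (s≤s (s≤s (s≤s (s≤s (s≤s (s≤s (s≤s ())))))))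

-- The five cases, for a fixed configuration A, s and d ∈ A₁ with q(d) = 1

module Cases (m : ℕ) {A : List ℤ} {s : ℕ} (s-qr : IsQR s)
             (res-qr : ∀ x → x ∈ A → IsQR (res7 x)) (d : ℤ) (qd≡1 : q m d ≡ 1) where

  A₁ A₂ A₄ : ℕ → Set
  A₁ = qPart m A s
  A₂ = qPart m A (2 ℕ.* s)
  A₄ = qPart m A (4 ℕ.* s)

  range-window : ∀ {L} → (∀ y → A₁ y → 1 ≤ y × y ≤ L) → ∀ y → A₁ y → InWindow 1 L y
  range-window range y A₁y =
    interval-window (qPart<7 {m} {A} {s} A₁y) (proj₁ (range y A₁y)) (proj₂ (range y A₁y))

  shift-criterion : ∀ t → SafeAfter A₁ t → SafeAfter A₂ (2 ℕ.* t) → SafeAfter A₄ (4 ℕ.* t) →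
    Avoids06 m A
  shift-criterion t safe₁ safe₂ safe₄ = k , ℕP.≤-pred (ℕD.m%n<n (t ℕ.* s ℕ.* s) 7) , avoid
    where
    k : ℕ
    k = (t ℕ.* s ℕ.* s) ℕ.% 7
    moved : ∀ j x → res7 x ≡ (j ℕ.* s) ℕ.% 7 → Safe ((q m x ℕ.+ j ℕ.* t) ℕ.% 7) →
      Safe (q m (lam m k ℤ.* x))
    moved j x rx = subst Safe (sym (trans (q-lam m k x)
      (trans (cong (λ r → (q m x ℕ.+ k ℕ.* r) ℕ.% 7) rx)
             (cube-root-shift 7 s t j (q m x) (qr-cube s-qr)))))
    avoid : ∀ x → x ∈ A → Safe (q m (lam m k ℤ.* x))
    avoid x x∈A with qr-classes s-qr (res-qr x x∈A)
    ... | inj₁ rx = moved 1 x (trans rx (cong (ℕ._% 7) (sym (ℕP.*-identityˡ s))))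
            (subst (λ c → Safe ((q m x ℕ.+ c) ℕ.% 7)) (sym (ℕP.*-identityˡ t))
                   (safe₁ (q m x) (x , (x∈A , rx) , refl)))
    ... | inj₂ (inj₁ rx) = moved 2 x rx (safe₂ (q m x) (x , (x∈A , rx) , refl))
    ... | inj₂ (inj₂ rx) = moved 4 x rx (safe₄ (q m x) (x , (x∈A , rx) , refl))

  -- Case (i), ℓ = (5,0,1).  With q(d) = 1, ẽ(d,d') equals 6 when q(d') = 0 and 4
  -- when q(d') = 6, so the hypothesis keeps q(A₄) safe and t = 0 works.
  case-i₄ : (∀ y → A₁ y → 1 ≤ y × y ≤ 5) → Covers A₂ 0 →
    (∀ d′ → InPart A (4 ℕ.* s) d′ → etilde4 m d d′ ≢ 4 × etilde4 m d d′ ≢ 6) → Avoids06 m A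
  case-i₄ range₁ cover₂ ẽ≢ =
    shift-criterion 0 (window-safe 1 (fits 1 5) (range-window range₁)) (empty-safe cover₂)
                      (unshifted-safe safe₄)
    where
    safe₄ : ∀ y → A₄ y → y < 7 × Safe y
    safe₄ y (x , x∈A₄ , qx≡y) = subst (_< 7) qx≡y (q<7 m x) ,
      (λ y≡0 → proj₂ (ẽ≢ x x∈A₄) (etilde4-at m d x 0 qd≡1 (trans qx≡y y≡0))) ,
      (λ y≡6 → proj₁ (ẽ≢ x x∈A₄) (etilde4-at m d x 6 qd≡1 (trans qx≡y y≡6)))

  -- Case (i), ℓ = (5,1,0).  Now ẽ(d,d') equals 2 when q(d') = 0 and 3 when
  -- q(d') = 6, so the hypothesis keeps q(A₂) safe and t = 0 works.
  case-i₂ : (∀ y → A₁ y → 1 ≤ y × y ≤ 5) → Covers A₄ 0 →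
    (∀ d′ → InPart A (2 ℕ.* s) d′ → etilde2 m d d′ ≢ 2 × etilde2 m d d′ ≢ 3) → Avoids06 m A
  case-i₂ range₁ cover₄ ẽ≢ =
    shift-criterion 0 (window-safe 1 (fits 1 5) (range-window range₁)) (unshifted-safe safe₂)
                      (empty-safe cover₄)
    where
    safe₂ : ∀ y → A₂ y → y < 7 × Safe y
    safe₂ y (x , x∈A₂ , qx≡y) = subst (_< 7) qx≡y (q<7 m x) ,
      (λ y≡0 → proj₁ (ẽ≢ x x∈A₂) (etilde2-at m d x 0 qd≡1 (trans qx≡y y≡0))) ,
      (λ y≡6 → proj₂ (ẽ≢ x x∈A₂) (etilde2-at m d x 6 qd≡1 (trans qx≡y y≡6)))

  case-ii₄ : (∀ y → A₁ y → 1 ≤ y × y ≤ 4) → Covers A₂ 0 → Covers A₄ 2 → Avoids06 m A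
  case-ii₄ range₁ cover₂ (b , b<7 , window₄) =
    let (t , fit₁ , fit₄) = shifts-ii₄ b b<7 in
    shift-criterion t (window-safe 1 fit₁ (range-window range₁)) (empty-safe cover₂)
                      (window-safe b fit₄ window₄)

  PairHyp : Set
  PairHyp = ∀ i → i < 7 →
    (∀ y → (A₂ y → y ≡ i ⊎ y ≡ (i ℕ.+ 1) ℕ.% 7) × (y ≡ i ⊎ y ≡ (i ℕ.+ 1) ℕ.% 7 → A₂ y)) →
    ∀ d′ → InPart A (2 ℕ.* s) d′ → q m d′ ≡ i → etilde2 m d d′ ≢ 4

  -- If q(A₂) ⊆ {5,6}, it cannot be all of {5,6}: for d' with q(d') = 5 we would get
  -- ẽ(d,d') = 2 − 5 = 4.
  not-both-56 : (∀ y → A₂ y → InWindow 5 2 y) → PairHyp → A₂ 6 → ¬ A₂ 5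
  not-both-56 window₂ hyp six (x , x∈A₂ , qx≡5) =
    hyp 5 (ℕP.m<n⇒m<1+n (ℕP.n<1+n 5)) q[A₂]≡56 x x∈A₂ qx≡5 (etilde2-at m d x 5 qd≡1 qx≡5)
    where
    q[A₂]≡56 : ∀ y → (A₂ y → y ≡ 5 ⊎ y ≡ 6) × (y ≡ 5 ⊎ y ≡ 6 → A₂ y)
    q[A₂]≡56 y = (λ A₂y → window₂-members {5} (window₂ y A₂y))
               , λ { (inj₁ refl) → x , x∈A₂ , qx≡5 ; (inj₂ refl) → six }

  shrink-56 : (∀ y → A₂ y → InWindow 5 2 y) → PairHyp →
    (∀ y → A₂ y → InWindow 5 1 y) ⊎ (∀ y → A₂ y → InWindow 6 1 y)
  shrink-56 window₂ hyp with qPart? m A (2 ℕ.* s) 6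
  ... | no ¬six = inj₁ only-5
    where
    only-5 : ∀ y → A₂ y → InWindow 5 1 y
    only-5 y A₂y with window₂-members {5} (window₂ y A₂y)
    ... | inj₁ refl = 0 , s≤s z≤n , refl
    ... | inj₂ refl = ⊥-elim (¬six A₂y)
  ... | yes six = inj₂ only-6
    where
    only-6 : ∀ y → A₂ y → InWindow 6 1 y
    only-6 y A₂y with window₂-members {5} (window₂ y A₂y)
    ... | inj₁ refl = ⊥-elim (not-both-56 window₂ hyp six A₂y)
    ... | inj₂ refl = 0 , s≤s z≤n , refl

  case-ii₂ : (∀ y → A₁ y → 1 ≤ y × y ≤ 4) → Covers A₂ 2 → Covers A₄ 0 → PairHyp → Avoids06 m A
  case-ii₂ range₁ (a , a<7 , window₂) cover₄ hyp with a ℕ.≟ 5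
  ... | no a≢5 =
    let (t , fit₁ , fit₂) = shifts-ii₂ a a<7 a≢5 in
    shift-criterion t (window-safe 1 fit₁ (range-window range₁)) (window-safe a fit₂ window₂)
                      (empty-safe cover₄)
  ... | yes refl with shrink-56 window₂ hyp
  ...   | inj₁ at-5 =
    shift-criterion 0 (window-safe 1 (fits 1 4) (range-window range₁)) (window-safe 5 (fits 5 1) at-5)
                      (empty-safe cover₄)
  ...   | inj₂ at-6 =
    shift-criterion 1 (window-safe 1 (fits 2 4) (range-window range₁)) (window-safe 6 (fits 1 1) at-6)
                      (empty-safe cover₄)

  case-iii : (∀ y → A₁ y → 1 ≤ y × y ≤ 3) → Covers A₂ 3 → Covers A₄ 0 → Avoids06 m A
  case-iii range₁ (a , a<7 , window₂) cover₄ =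
    let (t , fit₁ , fit₂) = shifts-iii a a<7 in
    shift-criterion t (window-safe 1 fit₁ (range-window range₁)) (window-safe a fit₂ window₂)
                      (empty-safe cover₄)

open Cases using (case-i₄; case-i₂; case-ii₄; case-ii₂; case-iii)

lemma4 : (m : ℕ) → 2 ≤ m →
    (A : List ℤ) → Unique A → length A ≡ 5 →
    (∀ x → x ∈ A → IsQR (res7 x)) →
    (s : ℕ) → IsQR s → (∀ t → IsQR t → count A t ≤ count A s) →
    (L1 L2 L4 : ℕ) →
    Len (qPart m A s) L1 → Len (qPart m A (2 ℕ.* s)) L2 → Len (qPart m A (4 ℕ.* s)) L4 →
    (∀ y → qPart m A s y → 1 ≤ y × y ≤ L1) →
    (d : ℤ) → InPart A s d → q m d ≡ 1 →
    ((L1 ≡ 5 × L2 ≡ 0 × L4 ≡ 1 ×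
        (∀ d' → InPart A (4 ℕ.* s) d' → etilde4 m d d' ≢ 4 × etilde4 m d d' ≢ 6))
     ⊎ (L1 ≡ 5 × L2 ≡ 1 × L4 ≡ 0 ×
        (∀ d' → InPart A (2 ℕ.* s) d' → etilde2 m d d' ≢ 2 × etilde2 m d d' ≢ 3))
     ⊎ (L1 ≡ 4 × L2 ≡ 0 × L4 ≡ 2)
     ⊎ (L1 ≡ 4 × L2 ≡ 2 × L4 ≡ 0 ×
        (∀ i → i < 7 →
          (∀ y → (qPart m A (2 ℕ.* s) y → y ≡ i ⊎ y ≡ (i ℕ.+ 1) ℕ.% 7)
                 × (y ≡ i ⊎ y ≡ (i ℕ.+ 1) ℕ.% 7 → qPart m A (2 ℕ.* s) y)) →
          ∀ d' → InPart A (2 ℕ.* s) d' → q m d' ≡ i → etilde2 m d d' ≢ 4))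
     ⊎ (L1 ≡ 3 × L2 ≡ 3 × L4 ≡ 0)) →
    ∃[ k ] (k ≤ 6 × (∀ x → x ∈ A → q m (lam m k ℤ.* x) ≢ 0 × q m (lam m k ℤ.* x) ≢ 6))
lemma4 m _ A _ _ res-qr s s-qr _ _ _ _ _ (cover₂ , _) (cover₄ , _) range₁ d _ qd≡1 hyp
  with hyp
... | inj₁ (refl , refl , refl , ẽ≢) =
  case-i₄ m s-qr res-qr d qd≡1 range₁ cover₂ ẽ≢
... | inj₂ (inj₁ (refl , refl , refl , ẽ≢)) =
  case-i₂ m s-qr res-qr d qd≡1 range₁ cover₄ ẽ≢
... | inj₂ (inj₂ (inj₁ (refl , refl , refl))) =
  case-ii₄ m s-qr res-qr d qd≡1 range₁ cover₂ cover₄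
... | inj₂ (inj₂ (inj₂ (inj₁ (refl , refl , refl , ẽ≢)))) =
  case-ii₂ m s-qr res-qr d qd≡1 range₁ cover₂ cover₄ ẽ≢
... | inj₂ (inj₂ (inj₂ (inj₂ (refl , refl , refl)))) =
  case-iii m s-qr res-qr d qd≡1 range₁ cover₂ cover₄
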